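{- Let $v_1,\dots,v_{d+1}\in\mathbb{Z}^d$ be affinely independent and let $\Delta=\operatorname{conv}\{v_1,\dots,v_{d+1}\}$. Let $z\in\mathbb{Z}^{d+1}$ be an integer point of the fundamental parallelepiped $\Pi_\Delta$, written uniquely as $z=\sum_{i=1}^{d+1}\gamma_i(1,v_i)$ with $0\le\gamma_i<1$, and let $\alpha=(\lfloor (d+1)\gamma_1\rfloor,\dots,\lfloor (d+1)\gamma_{d+1}\rfloor)\in\{0,\dots,d\}^{d+1}$ (so $z\in B_\alpha$). Then $$\operatorname{height}(z)=\left\lceil \frac{\sum_{i=1}^{d+1}\alpha_i}{d+1}\right\rceil.$$
   Context: For $z=(z_0,z_1,\dots,z_d)\in\mathbb{R}^{d+1}$, $\operatorname{height}(z):=z_0$. The fundamental parallelepiped is $\Pi_\Delta=\{\sum_{i=1}^{d+1}\gamma_i(1,v_i):0\le\gamma_i<1\}\subset\mathbb{R}^{d+1}$. For $\alpha\in\{0,\dots,d\}^{d+1}$, the bin $B_\alpha$ is the set of points of $\Pi_\Delta$ whose coefficient vector $(\gamma_i)$ satisfies $(\lfloor (d+1)\gamma_1\rfloor,\dots,\lfloor (d+1)\gamma_{d+1}\rfloor)=\alpha$. -}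

module Defs where

open import Data.Nat using (ℕ; zero; suc)
open import Data.Fin using (Fin; zero; suc)
open import Data.Integer using (ℤ)
import Data.Integer as ℤ
open import Data.Rational using (ℚ; 0ℚ; 1ℚ; _+_; _*_; _≤_; _<_; floor; ceiling; _/_)
import Data.Rational as ℚ
open import Relation.Binary.PropositionalEquality using (_≡_)

Σℚ : ∀ {n} → (Fin n → ℚ) → ℚ
Σℚ {zero}  f = 0ℚ
Σℚ {suc n} f = f zero + Σℚ (λ i → f (suc i))

Σℤ : ∀ {n} → (Fin n → ℤ) → ℤ
Σℤ {zero}  f = ℤ.+ 0
Σℤ {suc n} f = f zero ℤ.+ Σℤ (λ i → f (suc i))

-- points of ℤ^d / ℚ^(d+1) as functions on coordinates
-- a point of ℚ^(d+1) has coordinates indexed by Fin (suc d); coordinate zero is the height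
height : ∀ {d} → (Fin (suc d) → ℤ) → ℤ
height z = z zero

lift : ∀ {d} → (Fin d → ℤ) → Fin (suc d) → ℚ
lift v zero    = 1ℚ
lift v (suc j) = v j / 1

-- v_1..v_{d+1} ∈ ℤ^d affinely independent  ⇔  the lifted vectors (1,v_i) are
-- linearly independent (over ℚ, equivalently over ℝ since entries are integral)
AffinelyIndependent : ∀ {d} → (Fin (suc d) → Fin d → ℤ) → Set
AffinelyIndependent {d} v =
  (c : Fin (suc d) → ℚ) →
  (∀ k → Σℚ (λ i → c i * lift (v i) k) ≡ 0ℚ) →
  ∀ i → c i ≡ 0ℚ

Represents : ∀ {d} → (Fin (suc d) → Fin d → ℤ) → (Fin (suc d) → ℚ) → (Fin (suc d) → ℤ) → Set
Represents {d} v γ z =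
  (∀ i → 0ℚ ≤ γ i) × (∀ i → γ i < 1ℚ) ×
  (∀ k → z k / 1 ≡ Σℚ (λ i → γ i * lift (v i) k))
  where open import Data.Product using (_×_)

binIndex : ∀ {d} → (Fin (suc d) → ℚ) → Fin (suc d) → ℤ
binIndex {d} γ i = floor ((ℤ.+ suc d / 1) * γ i)

module Submission where

-- Let n = d + 1 and write the integer point as z = Σᵢ γᵢ (1, vᵢ) with
-- 0 ≤ γᵢ < 1.  The height coordinate of (1, vᵢ) is 1, so height z = Σᵢ γᵢ.
-- Every bin index αᵢ = ⌊n γᵢ⌋ satisfies αᵢ ≤ n γᵢ < αᵢ + 1, and summing
-- these n inequalities gives
--     A ≤ n · height z < A + n,      where A = Σᵢ αᵢ.
-- An integer h with A ≤ n h < A + n is exactly ⌈A / n⌉, which is the claim.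
-- Affine independence only guarantees that γ is unique; the statement fixes
-- γ, so the argument does not need it.

open import Defs

open import Data.Nat using (ℕ; suc)
open import Data.Fin using (Fin; zero; suc)
open import Data.Integer using (ℤ; +_; +<+; -1ℤ; 1ℤ; pred) renaming (suc to sucℤ)
import Data.Integer as ℤ
import Data.Integer.Properties as ℤP
open import Data.Integer.DivMod using (a≡a%n+[a/n]*n; n%d<d; [n/d]*d≤n)
open import Data.Integer.Solver using (module +-*-Solver)
open import Data.Rational using (ℚ; mkℚ; floor; ceiling; _/_; toℚᵘ)
import Data.Rational as ℚ
import Data.Rational.Properties as ℚP
open import Data.Rational.Unnormalised using (ℚᵘ; mkℚᵘ; *≤*; *<*; *≡*; _≃_)
import Data.Rational.Unnormalised as U
import Data.Rational.Unnormalised.Properties as UP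
open import Data.Product using (_×_; _,_; proj₁; proj₂)
open import Relation.Binary.PropositionalEquality

ι : ℤ → ℚ
ι x = x / 1

ιᵘ : ℤ → ℚᵘ
ιᵘ x = mkℚᵘ x 0

toℚᵘ-ι : ∀ x → toℚᵘ (ι x) ≃ ιᵘ x
toℚᵘ-ι x = ℚP.toℚᵘ-fromℚᵘ (ιᵘ x)

ι-+ : ∀ a b → ι (a ℤ.+ b) ≡ ι a ℚ.+ ι b
ι-+ a b = ℚP.toℚᵘ-injective (begin-equality
  toℚᵘ (ι (a ℤ.+ b))         ≃⟨ toℚᵘ-ι (a ℤ.+ b) ⟩
  ιᵘ (a ℤ.+ b)               ≃⟨ *≡* (cong (ℤ._* 1ℤ) (cong₂ ℤ._+_ (ℤP.*-identityʳ a) (ℤP.*-identityʳ b))) ⟨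
  ιᵘ a U.+ ιᵘ b              ≃⟨ UP.+-cong (toℚᵘ-ι a) (toℚᵘ-ι b) ⟨
  toℚᵘ (ι a) U.+ toℚᵘ (ι b)  ≃⟨ ℚP.toℚᵘ-homo-+ (ι a) (ι b) ⟨
  toℚᵘ (ι a ℚ.+ ι b)         ∎)
  where open UP.≤-Reasoning

ι-* : ∀ a b → ι (a ℤ.* b) ≡ ι a ℚ.* ι b
ι-* a b = ℚP.toℚᵘ-injective (begin-equality
  toℚᵘ (ι (a ℤ.* b))         ≃⟨ toℚᵘ-ι (a ℤ.* b) ⟩
  ιᵘ a U.* ιᵘ b              ≃⟨ UP.*-cong (toℚᵘ-ι a) (toℚᵘ-ι b) ⟨
  toℚᵘ (ι a) U.* toℚᵘ (ι b)  ≃⟨ ℚP.toℚᵘ-homo-* (ι a) (ι b) ⟨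
  toℚᵘ (ι a ℚ.* ι b)         ∎)
  where open UP.≤-Reasoning

ι-neg : ∀ a → ι (ℤ.- a) ≡ ℚ.- ι a
ι-neg a = ℚP.toℚᵘ-injective (begin-equality
  toℚᵘ (ι (ℤ.- a))  ≃⟨ toℚᵘ-ι (ℤ.- a) ⟩
  U.- ιᵘ a          ≃⟨ UP.-‿cong (toℚᵘ-ι a) ⟨
  U.- toℚᵘ (ι a)    ≃⟨ ℚP.toℚᵘ-homo‿- (ι a) ⟨
  toℚᵘ (ℚ.- ι a)    ∎)
  where open UP.≤-Reasoning

ι-cancel-≤ : ∀ {a b} → ι a ℚ.≤ ι b → a ℤ.≤ b
ι-cancel-≤ {a} {b} ιa≤ιb = subst₂ ℤ._≤_ (ℤP.*-identityʳ a) (ℤP.*-identityʳ b) (UP.drop-*≤*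
  (UP.≤-respʳ-≃ (toℚᵘ-ι b) (UP.≤-respˡ-≃ (toℚᵘ-ι a) (ℚP.toℚᵘ-mono-≤ ιa≤ιb))))

ι-cancel-< : ∀ {a b} → ι a ℚ.< ι b → a ℤ.< b
ι-cancel-< {a} {b} ιa<ιb = subst₂ ℤ._<_ (ℤP.*-identityʳ a) (ℤP.*-identityʳ b) (UP.drop-*<*
  (UP.<-respʳ-≃ (toℚᵘ-ι b) (UP.<-respˡ-≃ (toℚᵘ-ι a) (ℚP.toℚᵘ-mono-< ιa<ιb))))

i<suc[j]⇒i≤j : ∀ {i j} → i ℤ.< sucℤ j → i ℤ.≤ j
i<suc[j]⇒i≤j i<sj = ℤP.≮⇒≥ λ j<i → ℤP.<-irrefl refl (ℤP.<-≤-trans i<sj (ℤP.i<j⇒suc[i]≤j j<i))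

n<suc[n/d]*d : ∀ N m → N ℤ.< sucℤ (N ℤ./ + suc m) ℤ.* + suc m
n<suc[n/d]*d N m = begin-strict
  N                       ≡⟨ a≡a%n+[a/n]*n N D ⟩
  + (N ℤ.% D) ℤ.+ q ℤ.* D  <⟨ ℤP.+-monoˡ-< (q ℤ.* D) (+<+ (n%d<d N D)) ⟩
  D ℤ.+ q ℤ.* D            ≡⟨ ℤP.suc-* q D ⟨
  sucℤ q ℤ.* D             ∎
  where
  open ℤP.≤-Reasoning
  D = + suc m
  q = N ℤ./ D

floor-lower : ∀ p → ι (floor p) ℚ.≤ p
floor-lower p@(mkℚ N m _) = ℚP.toℚᵘ-cancel-≤ (UP.≤-respˡ-≃ (UP.≃-sym (toℚᵘ-ι (floor p)))
  (*≤* (subst (floor p ℤ.* + suc m ℤ.≤_) (sym (ℤP.*-identityʳ N)) ([n/d]*d≤n N (+ suc m)))))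

floor-upper : ∀ p → p ℚ.< ι (sucℤ (floor p))
floor-upper p@(mkℚ N m _) = ℚP.toℚᵘ-cancel-< (UP.<-respʳ-≃ (UP.≃-sym (toℚᵘ-ι (sucℤ (floor p))))
  (*<* (subst (ℤ._< sucℤ (floor p) ℤ.* + suc m) (sym (ℤP.*-identityʳ N)) (n<suc[n/d]*d N m))))

floor-unique : ∀ p k → ι k ℚ.≤ p → p ℚ.< ι (sucℤ k) → floor p ≡ k
floor-unique p k k≤p p<k+1 =
  ℤP.≤-antisym (below (floor-lower p) p<k+1) (below k≤p (floor-upper p))
  where
  below : ∀ {a b} → ι a ℚ.≤ p → p ℚ.< ι (sucℤ b) → a ℤ.≤ b
  below a≤p p<b+1 = i<suc[j]⇒i≤j (ι-cancel-< (ℚP.≤-<-trans a≤p p<b+1))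

ceiling-unique : ∀ p h → p ℚ.≤ ι h → ι (pred h) ℚ.< p → ceiling p ≡ h
ceiling-unique p@(mkℚ _ _ _) h p≤h h-1<p = begin
  ℤ.- floor (ℚ.- p)  ≡⟨ cong ℤ.-_ (floor-unique (ℚ.- p) (ℤ.- h) -h≤-p -p<1-h) ⟩
  ℤ.- (ℤ.- h)        ≡⟨ ℤP.neg-involutive h ⟩
  h                  ∎
  where
  open ≡-Reasoning
  -h≤-p : ι (ℤ.- h) ℚ.≤ ℚ.- p
  -h≤-p = subst (ℚ._≤ ℚ.- p) (sym (ι-neg h)) (ℚP.neg-antimono-≤ p≤h)
  -- -(h - 1) = 1 - h, i.e. sucℤ (- h)
  -p<1-h : ℚ.- p ℚ.< ι (sucℤ (ℤ.- h))
  -p<1-h = subst (ℚ.- p ℚ.<_) (trans (sym (ι-neg (pred h))) (cong ι (ℤP.neg-distrib-+ -1ℤ h)))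
             (ℚP.neg-antimono-< h-1<p)

ceiling-/ : ∀ A h m → A ℤ.≤ + suc m ℤ.* h → + suc m ℤ.* h ℤ.< A ℤ.+ + suc m →
  ceiling (A / suc m) ≡ h
ceiling-/ A h m A≤nh nh<A+n = ceiling-unique (A / suc m) h A/n≤h h-1<A/n
  where
  n = + suc m
  open +-*-Solver
  A/n≃A/n : toℚᵘ (A / suc m) ≃ mkℚᵘ A m
  A/n≃A/n = ℚP.toℚᵘ-fromℚᵘ (mkℚᵘ A m)
  A*1≤h*n : A ℤ.* 1ℤ ℤ.≤ h ℤ.* n
  A*1≤h*n = subst₂ ℤ._≤_ (sym (ℤP.*-identityʳ A)) (ℤP.*-comm n h) A≤nh
  [h-1]*n<A*1 : pred h ℤ.* n ℤ.< A ℤ.* 1ℤ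
  [h-1]*n<A*1 = subst₂ ℤ._<_
    (solve 2 (λ h n → n :* h :+ (:- n) := (con -1ℤ :+ h) :* n) refl h n)
    (solve 2 (λ A n → A :+ n :+ (:- n) := A :* con 1ℤ) refl A n)
    (ℤP.+-monoˡ-< (ℤ.- n) nh<A+n)
  A/n≤h : A / suc m ℚ.≤ ι h
  A/n≤h = ℚP.toℚᵘ-cancel-≤ (UP.≤-respˡ-≃ (UP.≃-sym A/n≃A/n)
            (UP.≤-respʳ-≃ (UP.≃-sym (toℚᵘ-ι h)) (*≤* A*1≤h*n)))
  h-1<A/n : ι (pred h) ℚ.< A / suc m
  h-1<A/n = ℚP.toℚᵘ-cancel-< (UP.<-respʳ-≃ (UP.≃-sym A/n≃A/n)
              (UP.<-respˡ-≃ (UP.≃-sym (toℚᵘ-ι (pred h))) (*<* [h-1]*n<A*1)))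

Σ-cong : ∀ {n} {f g : Fin n → ℚ} → (∀ i → f i ≡ g i) → Σℚ f ≡ Σℚ g
Σ-cong {ℕ.zero} f≡g = refl
Σ-cong {suc n}  f≡g = cong₂ ℚ._+_ (f≡g zero) (Σ-cong (λ i → f≡g (suc i)))

Σ-mono-≤ : ∀ {n} {f g : Fin n → ℚ} → (∀ i → f i ℚ.≤ g i) → Σℚ f ℚ.≤ Σℚ g
Σ-mono-≤ {ℕ.zero} f≤g = ℚP.≤-refl
Σ-mono-≤ {suc n}  f≤g = ℚP.+-mono-≤ (f≤g zero) (Σ-mono-≤ (λ i → f≤g (suc i)))

-- strictness needs at least one summand
Σ-mono-< : ∀ {n} {f g : Fin (suc n) → ℚ} → (∀ i → f i ℚ.< g i) → Σℚ f ℚ.< Σℚ g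
Σ-mono-< {ℕ.zero} f<g = ℚP.+-mono-<-≤ (f<g zero) ℚP.≤-refl
Σ-mono-< {suc n}  f<g = ℚP.+-mono-< (f<g zero) (Σ-mono-< (λ i → f<g (suc i)))

Σ-*ˡ : ∀ {n} c (f : Fin n → ℚ) → Σℚ (λ i → c ℚ.* f i) ≡ c ℚ.* Σℚ f
Σ-*ˡ {ℕ.zero} c f = sym (ℚP.*-zeroʳ c)
Σ-*ˡ {suc n}  c f = begin
  c ℚ.* f zero ℚ.+ Σℚ (λ i → c ℚ.* f (suc i))  ≡⟨ cong (c ℚ.* f zero ℚ.+_) (Σ-*ˡ c (λ i → f (suc i))) ⟩
  c ℚ.* f zero ℚ.+ c ℚ.* Σℚ (λ i → f (suc i))  ≡⟨ ℚP.*-distribˡ-+ c (f zero) _ ⟨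
  c ℚ.* Σℚ f                                   ∎
  where open ≡-Reasoning

Σ-ι : ∀ {n} (f : Fin n → ℤ) → Σℚ (λ i → ι (f i)) ≡ ι (Σℤ f)
Σ-ι {ℕ.zero} f = refl
Σ-ι {suc n}  f = trans (cong (ι (f zero) ℚ.+_) (Σ-ι (λ i → f (suc i)))) (sym (ι-+ (f zero) _))

Σℤ-suc : ∀ {n} (f : Fin n → ℤ) → Σℤ (λ i → sucℤ (f i)) ≡ Σℤ f ℤ.+ + n
Σℤ-suc {ℕ.zero} f = refl
Σℤ-suc {suc n}  f = trans (cong (λ s → sucℤ (f zero) ℤ.+ s) (Σℤ-suc (λ i → f (suc i))))
  (regroup (f zero) (Σℤ (λ i → f (suc i))) (+ n))
  where
  open +-*-Solver
  regroup : ∀ a s k → (1ℤ ℤ.+ a) ℤ.+ (s ℤ.+ k) ≡ (a ℤ.+ s) ℤ.+ (1ℤ ℤ.+ k)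
  regroup = solve 3 (λ a s k → (con 1ℤ :+ a) :+ (s :+ k) := (a :+ s) :+ (con 1ℤ :+ k)) refl

Σ-floor-bounds : ∀ {k} (x : Fin (suc k) → ℚ) →
  ι (Σℤ (λ i → floor (x i))) ℚ.≤ Σℚ x × Σℚ x ℚ.< ι (Σℤ (λ i → floor (x i)) ℤ.+ + suc k)
Σ-floor-bounds x =
  subst (ℚ._≤ Σℚ x) (Σ-ι ⌊x⌋) (Σ-mono-≤ (λ i → floor-lower (x i))) ,
  subst (Σℚ x ℚ.<_) (trans (Σ-ι (λ i → sucℤ (⌊x⌋ i))) (cong ι (Σℤ-suc ⌊x⌋)))
    (Σ-mono-< (λ i → floor-upper (x i)))
  where
  ⌊x⌋ : Fin _ → ℤ
  ⌊x⌋ i = floor (x i)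

proposition2p1 : (d : ℕ) (v : Fin (suc d) → Fin d → ℤ) → AffinelyIndependent v →
    (z : Fin (suc d) → ℤ) (γ : Fin (suc d) → ℚ) → Represents v γ z →
    height z ≡ ceiling (Σℤ (binIndex γ) / suc d)
proposition2p1 d v _ z γ (_ , _ , z≡Σγ[1,v]) =
  sym (ceiling-/ A h d (ι-cancel-≤ A≤nh) (ι-cancel-< nh<A+n))
  where
  n = + suc d
  A = Σℤ (binIndex γ)
  h = height z
  -- the height coordinate of every lifted vertex (1, vᵢ) is 1
  h≡Σγ : ι h ≡ Σℚ γ
  h≡Σγ = trans (z≡Σγ[1,v] zero) (Σ-cong (λ i → ℚP.*-identityʳ (γ i)))
  Σnγ≡nh : Σℚ (λ i → ι n ℚ.* γ i) ≡ ι (n ℤ.* h)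
  Σnγ≡nh = trans (Σ-*ˡ (ι n) γ) (trans (cong (ι n ℚ.*_) (sym h≡Σγ)) (sym (ι-* n h)))
  A≤nh : ι A ℚ.≤ ι (n ℤ.* h)
  A≤nh = subst (ι A ℚ.≤_) Σnγ≡nh (proj₁ (Σ-floor-bounds (λ i → ι n ℚ.* γ i)))
  nh<A+n : ι (n ℤ.* h) ℚ.< ι (A ℤ.+ n)
  nh<A+n = subst (ℚ._< ι (A ℤ.+ n)) Σnγ≡nh (proj₂ (Σ-floor-bounds (λ i → ι n ℚ.* γ i)))
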